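{- Let $\sigma\in\{0,1\}^n$ be written as $\sigma=\sigma_1\cdots\sigma_m$ with $m\ge2$, where $\sigma_1,\dots,\sigma_m$ are the maximal runs (blocks) of equal bits of $\sigma$. Suppose fewer than $0.01m$ of the blocks have length at least $2$. Consider the $m-1$ consecutive block pairs $(\sigma_j,\sigma_{j+1})$, $1\le j\le m-1$. Then either at least a $0.49$ fraction of these pairs are equal to $(0,1)$ (i.e. $\sigma_j\sigma_{j+1}=01$ with both blocks of length $1$), or at least a $0.49$ fraction of these pairs are equal to $(1,0)$. -}

module Defs where

open import Data.Bool using (Bool; true; false; if_then_else_; _∧_)
open import Data.Nat using (ℕ; zero; suc; _+_; _≡ᵇ_; _≤ᵇ_)
open import Data.Product using (_×_; _,_)
open import Data.List using (List; []; _∷_; foldr)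
open import Data.Vec using (Vec; toList)

-- Bits: 0 = false, 1 = true.

_==_ : Bool → Bool → Bool
true  == true  = true
false == false = true
_     == _     = false

-- A block (maximal run) is recorded as (bit , length), length ≥ 1.
Block : Set
Block = Bool × ℕ

addBit : Bool → List Block → List Block
addBit b [] = (b , 1) ∷ []
addBit b ((c , k) ∷ rs) =
  if b == c then (c , suc k) ∷ rs else (b , 1) ∷ (c , k) ∷ rs

runs : List Bool → List Block
runs = foldr addBit []

blocks : ∀ {n} → Vec Bool n → List Block
blocks σ = runs (toList σ)

longCount : List Block → ℕ
longCount [] = 0
longCount ((_ , k) ∷ rs) = (if 2 ≤ᵇ k then 1 else 0) + longCount rs

single : Bool → Block → Bool
single b (c , k) = (b == c) ∧ (k ≡ᵇ 1)

pairCount : Bool → Bool → List Block → ℕ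
pairCount a b [] = 0
pairCount a b (x ∷ []) = 0
pairCount a b (x ∷ y ∷ rs) =
  (if single a x ∧ single b y then 1 else 0) + pairCount a b (y ∷ rs)

count01 : List Block → ℕ
count01 = pairCount false true

count10 : List Block → ℕ
count10 = pairCount true false

module Submission where

-- Runs alternate in colour, so the m − 1 consecutive pairs of runs are, alternately, pairs
-- starting with the colour b of σ₁ and pairs starting with ¬b; at least (m − 1)/2 of them
-- start with b. The pairs starting with b are disjoint, and each one is either the pair b(¬b)
-- of two single bits or contains a long run. Hence m − 1 ≤ 2 (#b(¬b) + #long), and since
-- 100 #long ≤ m − 1 this gives 49 (m − 1) ≤ 100 #b(¬b).

open import Defs
open import Data.Bool using (Bool; true; false; not; if_then_else_; _∧_)
open import Data.Nat using (ℕ; zero; suc; _+_; _*_; _∸_; _≤_; _<_; _≤ᵇ_; z≤n; s≤s; s≤s⁻¹)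
open import Data.Nat.Properties
open import Data.Nat.Tactic.RingSolver using (solve)
open import Data.List using (List; []; _∷_; length)
open import Data.Vec using (Vec; toList)
open import Data.Product using (∃-syntax; _,_)
open import Data.Sum using (_⊎_; inj₁; inj₂)
open import Relation.Binary.PropositionalEquality using (_≡_; refl)

regroup-≤ : ∀ {e a a'} P L → 1 ≤ e + (a + a') → suc (P + L) ≤ (e + P) + (a + (a' + L))
regroup-≤ {e} {a} {a'} P L 1≤ = begin
  1 + (P + L)              ≤⟨ +-monoˡ-≤ (P + L) 1≤ ⟩
  (e + (a + a')) + (P + L) ≡⟨ solve (e ∷ a ∷ a' ∷ P ∷ L ∷ []) ⟩
  (e + P) + (a + (a' + L)) ∎
  where open ≤-Reasoning

fraction-bound : ∀ {m} c L → m ≤ suc (2 * (c + L)) → 100 * L < m → 49 * (m ∸ 1) ≤ 100 * c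
fraction-bound {suc m} c L m≤ (s≤s 100L≤m) = +-cancelʳ-≤ m (49 * m) (100 * c) (begin
  49 * m + m           ≡⟨ solve (m ∷ []) ⟩
  50 * m               ≤⟨ *-monoʳ-≤ 50 (s≤s⁻¹ m≤) ⟩
  50 * (2 * (c + L))   ≡⟨ solve (c ∷ L ∷ []) ⟩
  100 * c + 100 * L    ≤⟨ +-monoʳ-≤ (100 * c) 100L≤m ⟩
  100 * c + m          ∎)
  where open ≤-Reasoning

data Alternating : Bool → List Block → Set where
  []  : ∀ {b} → Alternating b []
  _∷_ : ∀ {b rs} k → Alternating (not b) rs → Alternating b ((b , suc k) ∷ rs)

addBit-alternating : ∀ b {c xs} → Alternating c xs → Alternating b (addBit b xs)
addBit-alternating b     []                = 0 ∷ []
addBit-alternating true  {true}  (k ∷ alt) = suc k ∷ alt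
addBit-alternating true  {false} (k ∷ alt) = 0 ∷ k ∷ alt
addBit-alternating false {true}  (k ∷ alt) = 0 ∷ k ∷ alt
addBit-alternating false {false} (k ∷ alt) = suc k ∷ alt

runs-alternating : ∀ bs → ∃[ b ] Alternating b (runs bs)
runs-alternating []       = true , []
runs-alternating (b ∷ bs) with runs-alternating bs
... | _ , alt = b , addBit-alternating b alt

pairsOrLong : Bool → List Block → ℕ
pairsOrLong b xs = pairCount b (not b) xs + longCount xs

pairCount-skip : ∀ b k rs → pairCount b (not b) ((not b , k) ∷ rs) ≡ pairCount b (not b) rs
pairCount-skip b     k []      = refl
pairCount-skip true  k (_ ∷ _) = refl
pairCount-skip false k (_ ∷ _) = refl

isPair : Bool → Bool → Block → Block → ℕ
isPair a c x y = if single a x ∧ single c y then 1 else 0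

isLong : Block → ℕ
isLong (_ , k) = if 2 ≤ᵇ k then 1 else 0

pair-or-long : ∀ b k k' →
  let x = (b , suc k); y = (not b , suc k') in 1 ≤ isPair b (not b) x y + (isLong x + isLong y)
pair-or-long true  zero    zero    = s≤s z≤n
pair-or-long true  zero    (suc _) = s≤s z≤n
pair-or-long true  (suc _) _       = s≤s z≤n
pair-or-long false zero    zero    = s≤s z≤n
pair-or-long false zero    (suc _) = s≤s z≤n
pair-or-long false (suc _) _       = s≤s z≤n

pairsOrLong-step : ∀ b k k' rs →
  suc (pairsOrLong b rs) ≤ pairsOrLong b ((b , suc k) ∷ (not b , suc k') ∷ rs)
pairsOrLong-step b k k' rs rewrite pairCount-skip b (suc k') rs =
  regroup-≤ {isPair b (not b) x y} {isLong x} {isLong y}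
    (pairCount b (not b) rs) (longCount rs) (pair-or-long b k k')
  where
  x = (b , suc k)
  y = (not b , suc k')

length≤1+2*pairsOrLong-step : ∀ b k k' rs → length rs ≤ suc (2 * pairsOrLong b rs) →
  let xs = (b , suc k) ∷ (not b , suc k') ∷ rs in length xs ≤ suc (2 * pairsOrLong b xs)
length≤1+2*pairsOrLong-step b k k' rs ih = s≤s (begin
  suc (length rs)            ≤⟨ s≤s ih ⟩
  2 + 2 * pairsOrLong b rs   ≡⟨ *-suc 2 (pairsOrLong b rs) ⟨
  2 * suc (pairsOrLong b rs) ≤⟨ *-monoʳ-≤ 2 (pairsOrLong-step b k k' rs) ⟩
  2 * pairsOrLong b ((b , suc k) ∷ (not b , suc k') ∷ rs) ∎)
  where open ≤-Reasoning

length≤1+2*pairsOrLong : ∀ {b xs} → Alternating b xs → length xs ≤ suc (2 * pairsOrLong b xs)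
length≤1+2*pairsOrLong []                     = z≤n
length≤1+2*pairsOrLong (_ ∷ [])               = s≤s z≤n
-- Splitting on b makes the colour not (not b) of alt reduce back to b.
length≤1+2*pairsOrLong {true}  {_ ∷ _ ∷ rs} (k ∷ k' ∷ alt) =
  length≤1+2*pairsOrLong-step true k k' rs (length≤1+2*pairsOrLong alt)
length≤1+2*pairsOrLong {false} {_ ∷ _ ∷ rs} (k ∷ k' ∷ alt) =
  length≤1+2*pairsOrLong-step false k k' rs (length≤1+2*pairsOrLong alt)

lemma7 : (n : ℕ) (σ : Vec Bool n) →
    2 ≤ length (blocks σ) →
    100 * longCount (blocks σ) < length (blocks σ) →
    (49 * (length (blocks σ) ∸ 1) ≤ 100 * count01 (blocks σ))
      ⊎ (49 * (length (blocks σ) ∸ 1) ≤ 100 * count10 (blocks σ))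
lemma7 n σ _ few-long with runs-alternating (toList σ)
... | false , alt = inj₁ (fraction-bound (count01 (blocks σ)) (longCount (blocks σ))
                           (length≤1+2*pairsOrLong alt) few-long)
... | true  , alt = inj₂ (fraction-bound (count10 (blocks σ)) (longCount (blocks σ))
                           (length≤1+2*pairsOrLong alt) few-long)
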